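{- Let $G=(V(G),E(G))$ be a finite simple graph and let $t,n$ be positive integers such that $n-t\ge 0$ and $n-t$ is even. Let $f:V(G)\to\{1,2,\dots,\chi(G)\}$ be a proper vertex coloring of $G$ using $\chi(G)$ colors. For $1\le k\le \chi(G)$ let $$A_k=\{x\in f^{ -1}(k): xy\in E(G) \text{ for all } y\in V(G)\setminus f^{ -1}(k)\},$$ and let $\varphi=\sum_{1\le k\le\chi(G),\ |A_k|>2}(|A_k|-2)$. Then $$\chi(Shu^t_n(G))=|V(G)|+1 \quad\text{if } n-t=0,$$ and $$\chi(Shu^t_n(G))\ge \max\{|V(G)|+1,\ 2\chi(G)+\varphi\}\quad\text{if } n-t>0.$$
   Context: The $(t,n)$-shuriken graph $Shu^t_n(G)$ (for positive integers $t,n$ with $n-t\ge 0$ even) is the simple graph constructed as follows. Add a new vertex $z$ to $G$ and take $n$ copies $G'_1,\dots,G'_n$ of the resulting vertex set $V(G)\cup\{z\}$; for $x\in V(G)\cup\{z\}$ and $1\le i\le n$, write $x_i$ for the copy of $x$ in $G'_i$. The vertex set is $\bigcup_{i=1}^n\{z_i, v_i : v\in V(G)\}$. The edge set consists of: (1) $u_iv_j$ for every edge $uv\in E(G)$ and all $i,j\in\{1,\dots,n\}$ (including $i=j$); (2) for each $i\in\{1,\dots,t\}$, all edges $u_iv_i$ between distinct vertices $u_i\neq v_i$ of $G'_i$; (3) for each $i\in\{t+1,\dots,\frac{n+t}{2}\}$, all edges $u_iv_{n+t+1-i}$ with $u_i\in V(G'_i)$ and $v_{n+t+1-i}\in V(G'_{n+t+1-i})$.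 $\chi(H)$ denotes the chromatic number of a graph $H$. -}

module Defs where

open import Data.Nat using (ℕ; zero; suc; _+_; _*_; _∸_; _≤_; _<_; _<ᵇ_; _⊔_)
open import Data.Fin using (Fin; toℕ)
open import Data.Fin.Properties using (all?)
open import Data.Maybe using (Maybe; just; nothing)
open import Data.Product using (Σ; _×_; _,_)
open import Data.Sum using (_⊎_)
open import Data.Bool using (if_then_else_)
open import Data.List using (List; length; filter; map; allFin)
open import Data.Nat.ListAction using (sum)
open import Relation.Nullary using (¬_; Dec; yes; no)
open import Data.Empty using (⊥-elim)
open import Relation.Unary using (Decidable)
open import Relation.Binary.PropositionalEquality using (_≡_; _≢_)
open import Data.Fin using (_≟_)
open import Relation.Nullary.Decidable using (¬?)
open import Data.Nat.Properties using () renaming (_≟_ to _≟ℕ_)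

record SimpleGraph (m : ℕ) : Set₁ where
  field
    Adj    : Fin m → Fin m → Set
    adj?   : ∀ x y → Dec (Adj x y)
    sym    : ∀ {x y} → Adj x y → Adj y x
    irrefl : ∀ {x} → ¬ Adj x x
open SimpleGraph public

IsProperColoring : {V : Set} → (V → V → Set) → (k : ℕ) → (V → Fin k) → Set
IsProperColoring Adj' k c = ∀ x y → Adj' x y → c x ≢ c y

Colorable : {V : Set} → (V → V → Set) → ℕ → Set
Colorable {V} Adj' k = Σ (V → Fin k) (IsProperColoring Adj' k)

IsChromaticNumber : {V : Set} → (V → V → Set) → ℕ → Set
IsChromaticNumber Adj' k = Colorable Adj' k × (∀ j → j < k → ¬ Colorable Adj' j)

-- Vertex x_i (x ∈ V(G) ∪ {z}, 1 ≤ i ≤ n) is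
-- represented by (i-1 , x) with z = nothing and v ∈ V(G) as just v.
-- In 0-based indices: (2) copies i with i < t are cliques; (3) copies i, j
-- with t ≤ i, t ≤ j and i + j + 1 = n + t are completely joined
-- (i.e. 1-based i' and n+t+1-i' for i' ∈ {t+1,…,(n+t)/2}).
ShuAdj : ∀ {m} → (G : SimpleGraph m) → (t n : ℕ) →
         (Fin n × Maybe (Fin m)) → (Fin n × Maybe (Fin m)) → Set
ShuAdj G t n (i , x) (j , y) =
    (Σ (Fin _) λ u → Σ (Fin _) λ v → x ≡ just u × y ≡ just v × Adj G u v)
  ⊎ ((i ≡ j × toℕ i < t) × x ≢ y)
  ⊎ (t ≤ toℕ i × t ≤ toℕ j × suc (toℕ i + toℕ j) ≡ n + t)

InA : ∀ {m c} → SimpleGraph m → (Fin m → Fin c) → Fin c → Fin m → Set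
InA G f k x = f x ≡ k × (∀ y → f y ≢ k → Adj G x y)

decImp : ∀ {P Q : Set} → Dec P → Dec Q → Dec (¬ P → Q)
decImp (yes p) _ = yes λ np → ⊥-elim (np p)
decImp (no np) (yes q) = yes λ _ → q
decImp (no np) (no nq) = no λ h → nq (h np)

inA? : ∀ {m c} (G : SimpleGraph m) (f : Fin m → Fin c) (k : Fin c) → Decidable (InA G f k)
inA? G f k x with f x ≟ k
... | no ¬p = no λ { (p , _) → ¬p p }
... | yes p with all? (λ y → decImp (f y ≟ k) (adj? G x y))
...   | yes h = yes (p , h)
...   | no nh = no λ { (_ , h) → nh h }

cardA : ∀ {m c} → SimpleGraph m → (Fin m → Fin c) → Fin c → ℕ
cardA {m} G f k = length (filter (inA? G f k) (allFin m))

φ : ∀ {m c} → SimpleGraph m → (Fin m → Fin c) → ℕ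
φ {m} {c} G f =
  sum (map (λ k → if 2 <ᵇ cardA G f k then cardA G f k ∸ 2 else 0) (allFin c))

-- Copy 1 of Shu^t_n(G) (t ≥ 1) together with its vertex z is a clique, so |V(G)| + 1
-- colours are needed, and colouring every x_i by x suffices when n = t.
--
-- For n > t the copies t + 1 and n are completely joined, so they carry disjoint
-- colour sets, each of them a proper colouring of G. A vertex a ∈ A_κ is adjacent to
-- every vertex outside class κ, so its colour in copy 1 can reappear in another copy
-- only on class κ. Recolouring each such vertex of class κ with the copy-1 colour of
-- the first (in copy t + 1), resp. second (in copy n), element of A_κ keeps both
-- colourings proper and disjoint, and makes them avoid the copy-1 colours of the
-- remaining |A_κ| − 2 elements of every A_κ. This gives 2χ(G) + φ distinct colours.
module Submission where

open import Defs
open import Data.Nat using (ℕ; suc; _+_; _*_; _∸_; _≤_; _<_; _⊔_; _<ᵇ_; s≤s⁻¹)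
open import Data.Nat.Divisibility using (_∣_)
open import Data.Nat.Properties
  using (≤-reflexive; <⇒≱; ≮⇒≥; <-≤-trans; +-comm; +-assoc; +-identityʳ; +-mono-≤; +-monoˡ-≤;
         ⊔-lub; m∸n≡0⇒m≤n; m∸n≢0⇒n<m; <⇒≢; module ≤-Reasoning)
open import Data.Nat.ListAction using (sum)
import Data.Fin as Fin
open import Data.Fin using (Fin; toℕ; fromℕ; fromℕ<; _≟_)
open import Data.Fin.Properties using (injective⇒≤; toℕ-fromℕ<; toℕ-fromℕ; toℕ<n; suc-injective)
open import Data.Maybe using (Maybe; just; nothing)
open import Data.Maybe.Properties using (just-injective)
open import Data.Product using (∃; _×_; _,_; proj₁; proj₂)
import Data.Product as Product
open import Data.Sum using (inj₁; inj₂; [_,_])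
open import Data.Bool using (if_then_else_)
open import Data.List using (List; []; _∷_; _++_; length; map; filter; concat; drop; lookup; allFin; deduplicate)
open import Data.List.Properties using (length-++; length-map; length-drop; map-cong)
open import Data.List.Relation.Unary.All as All using (_∷_)
import Data.List.Relation.Unary.All.Properties as All
open import Data.List.Relation.Unary.AllPairs as AllPairs using (_∷_)
import Data.List.Relation.Unary.AllPairs.Properties as AllPairs
open import Data.List.Relation.Unary.Any using (here; there; index; satisfied)
open import Data.List.Relation.Unary.Any.Properties using (lookup-index) renaming (map⁻ to Any-map⁻)
open import Data.List.Relation.Unary.Unique.Propositional using (Unique)
open import Data.List.Relation.Unary.Unique.Propositional.Properties
  using (++⁺; map⁺; drop⁺; filter⁺; allFin⁺; concat⁺)
open import Data.List.Relation.Unary.Unique.DecPropositional.Properties using (deduplicate-!)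
open import Data.List.Relation.Binary.Disjoint.Propositional using (Disjoint)
open import Data.List.Relation.Binary.Sublist.Propositional.Properties using (drop-⊆; Any-resp-⊆)
open import Data.List.Membership.Propositional using (_∈_; _∉_)
open import Data.List.Membership.Propositional.Properties
  using (∈-map⁺; ∈-map⁻; ∈-filter⁻; ∈-concat⁻; ∈-allFin; ∈-lookup; ∈-deduplicate⁺; ∈-deduplicate⁻; ∈-++⁻)
open import Function using (_∘_)
open import Function.Definitions using (Injective)
open import Relation.Binary.Definitions using (DecidableEquality)
open import Relation.Nullary using (¬_; Dec; yes; no; contradiction)
open import Relation.Binary.PropositionalEquality
  using (_≡_; _≢_; refl; cong; subst; ≢-sym; module ≡-Reasoning)
  renaming (sym to ≡-sym; trans to ≡-trans)

lookup-injective : ∀ {A : Set} {xs : List A} → Unique xs → Injective _≡_ _≡_ (lookup xs)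
lookup-injective {xs = _ ∷ _} _         {Fin.zero}  {Fin.zero}  _  = refl
lookup-injective {xs = _ ∷ _} (x∉ ∷ _)  {Fin.zero}  {Fin.suc j} eq = contradiction eq (All.lookup x∉ (∈-lookup j))
lookup-injective {xs = _ ∷ _} (x∉ ∷ _)  {Fin.suc i} {Fin.zero}  eq = contradiction (≡-sym eq) (All.lookup x∉ (∈-lookup i))
lookup-injective {xs = _ ∷ _} (_ ∷ xs!) {Fin.suc i} {Fin.suc j} eq = cong Fin.suc (lookup-injective xs! eq)

Unique⇒length≤ : ∀ {k} {xs : List (Fin k)} → Unique xs → length xs ≤ k
Unique⇒length≤ xs! = injective⇒≤ (lookup-injective xs!)

length-concat-map : ∀ {A B : Set} (g : A → List B) xs → length (concat (map g xs)) ≡ sum (map (length ∘ g) xs)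
length-concat-map g []       = refl
length-concat-map g (x ∷ xs) = ≡-trans (length-++ (g x)) (cong (length (g x) +_) (length-concat-map g xs))

∈-drop⁻ : ∀ {A : Set} n {xs : List A} {a} → a ∈ drop n xs → a ∈ xs
∈-drop⁻ n {xs} = Any-resp-⊆ (drop-⊆ n xs)

module _ {A : Set} where

  first second : A → List A → A
  first d []      = d
  first _ (a ∷ _) = a
  second d []          = d
  second _ (a ∷ [])    = a
  second _ (_ ∷ b ∷ _) = b

  IsPick : (A → List A → A) → Set
  IsPick pick = (∀ d {a xs} → a ∈ xs → pick d xs ∈ xs)
              × (∀ d {xs} → Unique xs → pick d xs ∉ drop 2 xs)

  first-isPick : IsPick first
  first-isPick = first-∈ , first∉drop2
    where
      first-∈ : ∀ d {a xs} → a ∈ xs → first d xs ∈ xs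
      first-∈ d {xs = _ ∷ _} _ = here refl
      first∉drop2 : ∀ d {xs} → Unique xs → first d xs ∉ drop 2 xs
      first∉drop2 d {_ ∷ _ ∷ _} (a∉ ∷ _) a∈ = All.lookup a∉ (there a∈) refl

  second-isPick : IsPick second
  second-isPick = second-∈ , second∉drop2
    where
      second-∈ : ∀ d {a xs} → a ∈ xs → second d xs ∈ xs
      second-∈ d {xs = _ ∷ []}    _ = here refl
      second-∈ d {xs = _ ∷ _ ∷ _} _ = there (here refl)
      second∉drop2 : ∀ d {xs} → Unique xs → second d xs ∉ drop 2 xs
      second∉drop2 d {_ ∷ _ ∷ _} (_ ∷ b∉ ∷ _) b∈ = All.lookup b∉ b∈ refl

  first≢second : ∀ {d d' a b xs} → Unique xs → a ∈ xs → b ∈ xs → a ≢ b → first d xs ≢ second d' xs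
  first≢second {xs = _ ∷ []}    _          (here a≡) (here b≡) a≢b _ = a≢b (≡-trans a≡ (≡-sym b≡))
  first≢second {xs = _ ∷ _ ∷ _} (a∉ ∷ _) _         _         _   = All.lookup a∉ (here refl)

NotColorableBelow : {V : Set} → (V → V → Set) → ℕ → Set
NotColorableBelow R c = ∀ j → j < c → ¬ Colorable R j

CrossProper : {V : Set} → (V → V → Set) → {k : ℕ} → (V → Fin k) → (V → Fin k) → Set
CrossProper R g g' = ∀ u v → R u v → g u ≢ g' v

module _ {V : Set} (R : V → V → Set) {k} {g : V → Fin k} (g-proper : IsProperColoring R k g) where

  cover⇒colorable : (ℓ : List (Fin k)) → (∀ x → g x ∈ ℓ) → Colorable R (length ℓ)
  cover⇒colorable ℓ cover = position , position-proper
    where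
      open ≡-Reasoning
      position : V → Fin (length ℓ)
      position x = index (cover x)
      position-proper : IsProperColoring R (length ℓ) position
      position-proper x y xRy eq = g-proper x y xRy (begin
        g x                   ≡⟨ lookup-index (cover x) ⟩
        lookup ℓ (position x) ≡⟨ cong (lookup ℓ) eq ⟩
        lookup ℓ (position y) ≡⟨ lookup-index (cover y) ⟨
        g y                   ∎)

  χ≤length-cover : ∀ {c} → NotColorableBelow R c → (ℓ : List (Fin k)) → (∀ x → g x ∈ ℓ) → c ≤ length ℓ
  χ≤length-cover χ ℓ cover = ≮⇒≥ λ ℓ<c → χ _ ℓ<c (cover⇒colorable ℓ cover)

  clique⇒injective : {A : Set} → DecidableEquality A → (e : A → V) →
                     (∀ {a b} → a ≢ b → R (e a) (e b)) → Injective _≡_ _≡_ (g ∘ e)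
  clique⇒injective _≟ₐ_ e clique {a} {b} eq with a ≟ₐ b
  ... | yes a≡b = a≡b
  ... | no  a≢b = contradiction eq (g-proper _ _ (clique a≢b))

module _ {m k : ℕ} where

  image : (Fin m → Fin k) → List (Fin k)
  image g = deduplicate _≟_ (map g (allFin m))

  ∈-image⁺ : ∀ g x → g x ∈ image g
  ∈-image⁺ g x = ∈-deduplicate⁺ _≟_ (∈-map⁺ g (∈-allFin x))

  ∈-image⁻ : ∀ g {γ} → γ ∈ image g → ∃ λ x → γ ≡ g x
  ∈-image⁻ g γ∈ = Product.map₂ proj₂ (∈-map⁻ g (∈-deduplicate⁻ _≟_ (map g (allFin m)) γ∈))

  image-disjoint : ∀ g {ys} → (∀ x → g x ∉ ys) → Disjoint (image g) ys
  image-disjoint g g∉ys (γ∈image , γ∈ys) with ∈-image⁻ g γ∈image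
  ... | x , refl = g∉ys x γ∈ys

disjoint-colorings-bound :
  ∀ {m c k} {R : Fin m → Fin m → Set} → NotColorableBelow R c →
  {g g' : Fin m → Fin k} → IsProperColoring R k g → IsProperColoring R k g' → (∀ x y → g x ≢ g' y) →
  (X : List (Fin k)) → Unique X → (∀ x → g x ∉ X) → (∀ x → g' x ∉ X) →
  2 * c + length X ≤ k
disjoint-colorings-bound {c = c} {k} {R} χ {g} {g'} g-proper g'-proper g≢g' X X! g∉X g'∉X = begin
  2 * c + length X                                   ≡⟨ +-assoc c (c + 0) (length X) ⟩
  c + (c + 0 + length X)                             ≡⟨ cong (λ w → c + (w + length X)) (+-identityʳ c) ⟩
  c + (c + length X)                                 ≤⟨ +-mono-≤ g-colors (+-monoˡ-≤ (length X) g'-colors) ⟩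
  length (image g) + (length (image g') + length X)  ≡⟨ cong (length (image g) +_) (length-++ (image g')) ⟨
  length (image g) + length (image g' ++ X)          ≡⟨ length-++ (image g) ⟨
  length (image g ++ image g' ++ X)                  ≤⟨ Unique⇒length≤ colors-unique ⟩
  k                                                  ∎
  where
    open ≤-Reasoning
    g-colors : c ≤ length (image g)
    g-colors = χ≤length-cover R g-proper χ (image g) (∈-image⁺ g)
    g'-colors : c ≤ length (image g')
    g'-colors = χ≤length-cover R g'-proper χ (image g') (∈-image⁺ g')
    g∉rest : ∀ x → g x ∉ image g' ++ X
    g∉rest x gx∈ = [ (λ gx∈g' → g≢g' x _ (proj₂ (∈-image⁻ g' gx∈g'))) , g∉X x ] (∈-++⁻ (image g') gx∈)
    colors-unique : Unique (image g ++ image g' ++ X)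
    colors-unique = ++⁺ (deduplicate-! _≟_ _)
                        (++⁺ (deduplicate-! _≟_ _) X! (image-disjoint g' g'∉X))
                        (image-disjoint g g∉rest)

if-2<ᵇ-then-∸2≡∸2 : ∀ n → (if 2 <ᵇ n then n ∸ 2 else 0) ≡ n ∸ 2
if-2<ᵇ-then-∸2≡∸2 0                   = refl
if-2<ᵇ-then-∸2≡∸2 1                   = refl
if-2<ᵇ-then-∸2≡∸2 2                   = refl
if-2<ᵇ-then-∸2≡∸2 (suc (suc (suc n))) = refl

module Recoloring {m c k} (G : SimpleGraph m) (f : Fin m → Fin c) (f-proper : IsProperColoring (Adj G) c f)
                  (h₀ : Fin m → Fin k) (h₀-injective : Injective _≡_ _≡_ h₀) where

  open import Data.List.Membership.DecPropositional (_≟_ {k}) using (_∈?_)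

  A : Fin c → List (Fin m)
  A κ = filter (inA? G f κ) (allFin m)

  A-unique : ∀ κ → Unique (A κ)
  A-unique κ = filter⁺ (inA? G f κ) (allFin⁺ m)

  ∈A⇒InA : ∀ {κ a} → a ∈ A κ → InA G f κ a
  ∈A⇒InA {κ} = proj₂ ∘ ∈-filter⁻ (inA? G f κ) {xs = allFin m}

  same-h₀-color⇒same-class : ∀ {κ κ' a b} → a ∈ A κ → b ∈ A κ' → h₀ a ≡ h₀ b → κ ≡ κ'
  same-h₀-color⇒same-class {κ} {κ'} {a} {b} a∈ b∈ eq = begin
    κ   ≡⟨ proj₁ (∈A⇒InA a∈) ⟨
    f a ≡⟨ cong f (h₀-injective eq) ⟩
    f b ≡⟨ proj₁ (∈A⇒InA b∈) ⟩
    κ'  ∎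
    where open ≡-Reasoning

  surplus : List (Fin m)
  surplus = concat (map (drop 2 ∘ A) (allFin c))

  surplus-unique : Unique surplus
  surplus-unique = concat⁺ (All.map⁺ (All.universal (drop⁺ 2 ∘ A-unique) _))
                           (AllPairs.map⁺ (AllPairs.map classes-disjoint (allFin⁺ c)))
    where
      classes-disjoint : ∀ {κ κ'} → κ ≢ κ' → Disjoint (drop 2 (A κ)) (drop 2 (A κ'))
      classes-disjoint κ≢κ' (a∈ , a∈') =
        κ≢κ' (same-h₀-color⇒same-class (∈-drop⁻ 2 a∈) (∈-drop⁻ 2 a∈') refl)

  length-surplus : length surplus ≡ φ G f
  length-surplus = ≡-trans (length-concat-map (drop 2 ∘ A) (allFin c)) (cong sum (map-cong excess (allFin c)))
    where
      excess : ∀ κ → length (drop 2 (A κ)) ≡ (if 2 <ᵇ cardA G f κ then cardA G f κ ∸ 2 else 0)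
      excess κ = ≡-trans (length-drop 2 (A κ)) (≡-sym (if-2<ᵇ-then-∸2≡∸2 (cardA G f κ)))

  ∈-surplus⁻ : ∀ {a} → a ∈ surplus → ∃ λ κ → a ∈ drop 2 (A κ)
  ∈-surplus⁻ = satisfied ∘ Any-map⁻ ∘ ∈-concat⁻ (map (drop 2 ∘ A) (allFin c))

  h₀-picked∉surplus : ∀ {pick} → IsPick pick → ∀ {d κ κ' a s} → a ∈ A κ → s ∈ drop 2 (A κ') →
                      h₀ (pick d (A κ)) ≢ h₀ s
  h₀-picked∉surplus (pick-∈ , pick∉drop2) {d} {κ} a∈ s∈ eq
    with same-h₀-color⇒same-class (pick-∈ d a∈) (∈-drop⁻ 2 s∈) eq
  ... | refl = pick∉drop2 d (A-unique κ) (subst (_∈ drop 2 (A κ)) (≡-sym (h₀-injective eq)) s∈)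

  h₀-first≢h₀-second : ∀ {d d' κ κ' a b} → a ∈ A κ → b ∈ A κ' → h₀ a ≢ h₀ b →
                       h₀ (first d (A κ)) ≢ h₀ (second d' (A κ'))
  h₀-first≢h₀-second {d} {d'} {κ} a∈ b∈ h₀a≢h₀b eq
    with same-h₀-color⇒same-class (proj₁ first-isPick d a∈) (proj₁ second-isPick d' b∈) eq
  ... | refl = first≢second (A-unique κ) a∈ b∈ (h₀a≢h₀b ∘ cong h₀) (h₀-injective eq)

  module _ (h : Fin m → Fin k) (h₀⊥h : CrossProper (Adj G) h₀ h) where

    Special : Fin m → Set
    Special y = h y ∈ map h₀ (A (f y))

    shared-color⇒class : ∀ {κ a y} → a ∈ A κ → h₀ a ≡ h y → f y ≡ κ
    shared-color⇒class {κ} {a} {y} a∈ eq with f y ≟ κ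
    ... | yes fy≡κ = fy≡κ
    ... | no  fy≢κ = contradiction eq (h₀⊥h a y (proj₂ (∈A⇒InA a∈) y fy≢κ))

    ¬special⇒≢h₀ : ∀ {y κ a} → ¬ Special y → a ∈ A κ → h₀ a ≢ h y
    ¬special⇒≢h₀ {y} ¬special a∈ eq =
      ¬special (subst (λ κ → h y ∈ map h₀ (A κ)) (≡-sym (shared-color⇒class a∈ eq))
                      (subst (_∈ map h₀ _) eq (∈-map⁺ h₀ a∈)))

    special? : ∀ y → Dec (Special y)
    special? y = h y ∈? map h₀ (A (f y))

    special⇒∈A : ∀ {y} → Special y → ∃ λ a → a ∈ A (f y) × h y ≡ h₀ a
    special⇒∈A = ∈-map⁻ h₀

    picked∈A : ∀ {pick} → IsPick pick → ∀ {x} → Special x → pick x (A (f x)) ∈ A (f x)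
    picked∈A (pick-∈ , _) {x} sp = pick-∈ x (proj₁ (proj₂ (special⇒∈A sp)))

    recolor : (Fin m → List (Fin m) → Fin m) → Fin m → Fin k
    recolor pick x with special? x
    ... | yes _ = h₀ (pick x (A (f x)))
    ... | no  _ = h x

    recolor-proper : IsProperColoring (Adj G) k h → ∀ {pick} → IsPick pick →
                     IsProperColoring (Adj G) k (recolor pick)
    recolor-proper h-proper isPick x y x~y with special? x | special? y
    ... | no  _   | no  _   = h-proper x y x~y
    ... | yes spx | no ¬spy = ¬special⇒≢h₀ ¬spy (picked∈A isPick spx)
    ... | no ¬spx | yes spy = ≢-sym (¬special⇒≢h₀ ¬spx (picked∈A isPick spy))
    ... | yes spx | yes spy =
      f-proper x y x~y ∘ same-h₀-color⇒same-class (picked∈A isPick spx) (picked∈A isPick spy)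

    recolor∉surplus : ∀ {pick} → IsPick pick → ∀ x → recolor pick x ∉ map h₀ surplus
    recolor∉surplus isPick x with special? x
    ... | yes sp = λ γ∈ →
      let s , s∈ , eq = ∈-map⁻ h₀ γ∈ in
      h₀-picked∉surplus isPick (proj₁ (proj₂ (special⇒∈A sp))) (proj₂ (∈-surplus⁻ s∈)) eq
    ... | no ¬sp = λ γ∈ →
      let s , s∈ , eq = ∈-map⁻ h₀ γ∈ in
      ¬special⇒≢h₀ ¬sp (∈-drop⁻ 2 (proj₂ (∈-surplus⁻ s∈))) (≡-sym eq)

  recolor-first≢recolor-second :
    ∀ {hP hQ} (h₀⊥hP : CrossProper (Adj G) h₀ hP) (h₀⊥hQ : CrossProper (Adj G) h₀ hQ) →
    (∀ x y → hP x ≢ hQ y) → ∀ x y → recolor hP h₀⊥hP first x ≢ recolor hQ h₀⊥hQ second y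
  recolor-first≢recolor-second {hP} {hQ} h₀⊥hP h₀⊥hQ hP≢hQ x y
    with special? hP h₀⊥hP x | special? hQ h₀⊥hQ y
  ... | no  _   | no  _   = hP≢hQ x y
  ... | yes spx | no ¬spy = ¬special⇒≢h₀ hQ h₀⊥hQ ¬spy (picked∈A hP h₀⊥hP first-isPick spx)
  ... | no ¬spx | yes spy = ≢-sym (¬special⇒≢h₀ hP h₀⊥hP ¬spx (picked∈A hQ h₀⊥hQ second-isPick spy))
  ... | yes spx | yes spy =
    let a , a∈ , hPx≡h₀a = special⇒∈A hP h₀⊥hP spx
        b , b∈ , hQy≡h₀b = special⇒∈A hQ h₀⊥hQ spy
    in h₀-first≢h₀-second a∈ b∈ λ h₀a≡h₀b →
         hP≢hQ x y (≡-trans hPx≡h₀a (≡-trans h₀a≡h₀b (≡-sym hQy≡h₀b)))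

  2χ+φ≤k : NotColorableBelow (Adj G) c → ∀ {hP hQ} →
           IsProperColoring (Adj G) k hP → IsProperColoring (Adj G) k hQ →
           (h₀⊥hP : CrossProper (Adj G) h₀ hP) (h₀⊥hQ : CrossProper (Adj G) h₀ hQ) →
           (∀ x y → hP x ≢ hQ y) → 2 * c + φ G f ≤ k
  2χ+φ≤k χ {hP} {hQ} hP-proper hQ-proper h₀⊥hP h₀⊥hQ hP≢hQ =
    subst (λ l → 2 * c + l ≤ k) (≡-trans (length-map h₀ surplus) length-surplus)
      (disjoint-colorings-bound χ
        (recolor-proper hP h₀⊥hP hP-proper first-isPick)
        (recolor-proper hQ h₀⊥hQ hQ-proper second-isPick)
        (recolor-first≢recolor-second h₀⊥hP h₀⊥hQ hP≢hQ)
        (map h₀ surplus) (map⁺ h₀-injective surplus-unique)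
        (recolor∉surplus hP h₀⊥hP first-isPick)
        (recolor∉surplus hQ h₀⊥hQ second-isPick))

maybeToFin : ∀ {m} → Maybe (Fin m) → Fin (suc m)
maybeToFin nothing  = Fin.zero
maybeToFin (just a) = Fin.suc a

finToMaybe : ∀ {m} → Fin (suc m) → Maybe (Fin m)
finToMaybe Fin.zero    = nothing
finToMaybe (Fin.suc a) = just a

maybeToFin-finToMaybe : ∀ {m} (i : Fin (suc m)) → maybeToFin (finToMaybe i) ≡ i
maybeToFin-finToMaybe Fin.zero    = refl
maybeToFin-finToMaybe (Fin.suc a) = refl

maybeToFin-injective : ∀ {m} → Injective _≡_ _≡_ (maybeToFin {m})
maybeToFin-injective {x = nothing} {nothing} _  = refl
maybeToFin-injective {x = just a}  {just b}  eq = cong just (suc-injective eq)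

module Shuriken {m} (G : SimpleGraph m) (t : ℕ) where

  copy-clique : ∀ {n} {i : Fin n} {x y} → toℕ i < t → x ≢ y → ShuAdj G t n (i , x) (i , y)
  copy-clique i<t x≢y = inj₂ (inj₁ ((refl , i<t) , x≢y))

  lift-edge : ∀ {n} (i j : Fin n) {u v} → Adj G u v → ShuAdj G t n (i , just u) (j , just v)
  lift-edge i j {u} {v} u~v = inj₁ (u , v , refl , refl , u~v)

  joined-copies : ∀ {n} (t<n : t < suc n) x y → ShuAdj G t (suc n) (fromℕ< t<n , x) (fromℕ n , y)
  joined-copies {n} t<n x y = inj₂ (inj₂ (t≤p , t≤q , p+q≡n+t))
    where
      t≤p : t ≤ toℕ (fromℕ< t<n)
      t≤p = ≤-reflexive (≡-sym (toℕ-fromℕ< t<n))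
      t≤q : t ≤ toℕ (fromℕ n)
      t≤q = subst (t ≤_) (≡-sym (toℕ-fromℕ n)) (s≤s⁻¹ t<n)
      p+q≡n+t : suc (toℕ (fromℕ< t<n) + toℕ (fromℕ n)) ≡ suc n + t
      p+q≡n+t rewrite toℕ-fromℕ< t<n | toℕ-fromℕ n = cong suc (+-comm t n)

  clique-bound : ∀ {n k} → 1 ≤ t → Colorable (ShuAdj G t (suc n)) k → suc m ≤ k
  clique-bound 1≤t (h , h-proper) =
    injective⇒≤ (clique⇒injective _ h-proper _≟_ (λ i → Fin.zero , finToMaybe i)
                   λ i≢j → copy-clique 1≤t (i≢j ∘ finToMaybe-injective))
    where
      finToMaybe-injective : ∀ {i j : Fin (suc m)} → finToMaybe i ≡ finToMaybe j → i ≡ j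
      finToMaybe-injective {i} {j} eq = begin
        i                         ≡⟨ maybeToFin-finToMaybe i ⟨
        maybeToFin (finToMaybe i) ≡⟨ cong maybeToFin eq ⟩
        maybeToFin (finToMaybe j) ≡⟨ maybeToFin-finToMaybe j ⟩
        j                         ∎
        where open ≡-Reasoning

  vertex-coloring-proper : ∀ {n} → n ≤ t → IsProperColoring (ShuAdj G t n) (suc m) (maybeToFin ∘ proj₂)
  vertex-coloring-proper _ _ _ (inj₁ (u , v , refl , refl , u~v)) eq =
    irrefl G (subst (Adj G u) (≡-sym (suc-injective eq)) u~v)
  vertex-coloring-proper _ _ _ (inj₂ (inj₁ (_ , x≢y))) eq = x≢y (maybeToFin-injective eq)
  vertex-coloring-proper n≤t (i , _) _ (inj₂ (inj₂ (t≤i , _))) _ = <⇒≱ (<-≤-trans (toℕ<n i) n≤t) t≤i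

  2χ+φ≤colors : ∀ {n c k} {f : Fin m → Fin c} → IsProperColoring (Adj G) c f → NotColorableBelow (Adj G) c →
                1 ≤ t → t < suc n → Colorable (ShuAdj G t (suc n)) k → 2 * c + φ G f ≤ k
  2χ+φ≤colors {n} {c} {k} {f} f-proper χ 1≤t t<n (h , h-proper) =
    Recoloring.2χ+φ≤k G f f-proper (copy Fin.zero) h₀-injective χ
      (copies-cross p p) (copies-cross q q) (copies-cross Fin.zero p) (copies-cross Fin.zero q)
      (λ x y → h-proper _ _ (joined-copies t<n (just x) (just y)))
    where
      p q : Fin (suc n)
      p = fromℕ< t<n
      q = fromℕ n
      copy : Fin (suc n) → Fin m → Fin k
      copy i x = h (i , just x)
      copies-cross : ∀ i j → CrossProper (Adj G) (copy i) (copy j)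
      copies-cross i j u v u~v = h-proper _ _ (lift-edge i j u~v)
      h₀-injective : Injective _≡_ _≡_ (copy Fin.zero)
      h₀-injective = clique⇒injective _ h-proper _≟_ (λ a → Fin.zero , just a)
                       λ a≢b → copy-clique 1≤t (a≢b ∘ just-injective)

mainTheorem2 : ∀ {m : ℕ} (G : SimpleGraph m) (t n : ℕ) →
    1 ≤ t → 1 ≤ n → t ≤ n → 2 ∣ (n ∸ t) →
    (c : ℕ) → IsChromaticNumber (Adj G) c →
    (f : Fin m → Fin c) → IsProperColoring (Adj G) c f →
    (n ∸ t ≡ 0 → IsChromaticNumber (ShuAdj G t n) (suc m))
    × (0 < n ∸ t → ∀ k → IsChromaticNumber (ShuAdj G t n) k →
         suc m ⊔ (2 * c + φ G f) ≤ k)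
mainTheorem2 {m} G t (suc n) 1≤t _ _ _ c (_ , χ) f f-proper = n≡t , t<n
  where
    open Shuriken G t
    n≡t : suc n ∸ t ≡ 0 → IsChromaticNumber (ShuAdj G t (suc n)) (suc m)
    n≡t n∸t≡0 = (maybeToFin ∘ proj₂ , vertex-coloring-proper (m∸n≡0⇒m≤n n∸t≡0))
              , λ j j<1+m colorable → <⇒≱ j<1+m (clique-bound 1≤t colorable)
    t<n : 0 < suc n ∸ t → ∀ k → IsChromaticNumber (ShuAdj G t (suc n)) k → suc m ⊔ (2 * c + φ G f) ≤ k
    t<n 0<n∸t k (colorable , _) =
      ⊔-lub (clique-bound 1≤t colorable)
            (2χ+φ≤colors f-proper χ 1≤t (m∸n≢0⇒n<m (≢-sym (<⇒≢ 0<n∸t))) colorable)
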